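{- Let $H_n$ be the total number of nonempty chains in all plane trees with $n$ edges. Then $\sum_{n\ge0}H_nx^n=\frac{2B}{3-B}$, where $B=\frac{1}{\sqrt{1-4x}}$.
   Context: A plane tree is a rooted tree with linearly ordered children. A chain in a plane tree is a nonempty set of vertices all lying on a single path from the root to a leaf. $H_n$ is the number of pairs $(T,Q)$ with $T$ a plane tree with $n$ edges and $Q$ a chain of $T$. -}

module Defs where

open import Data.Nat using (ℕ; zero; suc; _∸_)
import Data.Nat as ℕ
open import Data.Integer using (ℤ; +_; _-_; _*_; _+_)
open import Data.List using (List; []; _∷_; map; foldr; upTo)
open import Data.List.Relation.Unary.Any using (Any)
open import Data.Product using (Σ; _×_)
open import Relation.Binary.PropositionalEquality using (_≡_)

data Tree : Set where
  node : List Tree → Tree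

mutual
  edges : Tree → ℕ
  edges (node ts) = edgesF ts

  edgesF : List Tree → ℕ
  edgesF []       = 0
  edgesF (t ∷ ts) = suc (edges t) ℕ.+ edgesF ts

-- Chains: nonempty sets of vertices lying on one root-to-leaf path.
-- A chain S of  node ts  is described uniquely by:
--   * whether the root is in S, and
--   * the part of S below the root, which is either empty (only allowed
--     when the root is in S, by nonemptiness) or a chain lying entirely
--     inside exactly one child subtree (the one the path passes through).

data Chain : Tree → Set where
  rootOnly  : ∀ {ts} → Chain (node ts)
  rootAnd   : ∀ {ts} → Any Chain ts → Chain (node ts)
  belowRoot : ∀ {ts} → Any Chain ts → Chain (node ts)

Pairs : ℕ → Set
Pairs n = Σ Tree (λ T → (edges T ≡ n) × Chain T)

Series : Set
Series = ℕ → ℤ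

_⋆_ : Series → Series → Series
(f ⋆ g) n = foldr _+_ (+ 0) (map (λ k → f k * g (n ∸ k)) (upTo (suc n)))

_⊕_ : Series → Series → Series
(f ⊕ g) n = f n + g n

_⊖_ : Series → Series → Series
(f ⊖ g) n = f n - g n

const : ℤ → Series
const c zero    = c
const c (suc _) = + 0

X : Series
X (suc zero) = + 1
X _          = + 0

oneMinus4x : Series
oneMinus4x = const (+ 1) ⊖ (const (+ 4) ⋆ X)

ofℕ : (ℕ → ℕ) → Series
ofℕ h n = + h n

-- Forests of plane trees with n edges are counted by the Catalan numbers, whose series F
-- satisfies F = 1 + x F². A chain of  node ts  is the root alone, the root together with a
-- chain inside one subtree, or a chain inside one subtree alone; so G = F + 2 C, where C
-- counts forests with a chain marked in one of their trees, and splitting off the first tree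
-- gives C = x (G F + F C). Eliminating C yields G (3 - 2F) = F. With P = B (2 - F) one finds
-- (P² - F²)(1 - 4x) = 0 from B² (1 - 4x) = 1 and F = 1 + x F², hence P = F, and then
-- G (3 - B)(2 - F) = 2 B (2 - F). Every cancellation is legitimate because a power series
-- over ℤ with nonzero constant term is not a zero divisor.
module Submission where

open import Defs
open import Algebra.Bundles using (Ring)
open import Data.Fin using (Fin)
open import Data.Integer using (+_)
open import Data.Nat using (ℕ)
open import Function.Bundles using (_↔_)
open import Level using (Level)
open import Relation.Binary.PropositionalEquality using (_≡_)

module _ {ℓ₁ ℓ₂ : Level} (R : Ring ℓ₁ ℓ₂) where
  open Ring R
  open import Algebra.Properties.Group +-group using (x∙y⁻¹≈ε⇒x≈y; x≈y⇒x∙y⁻¹≈ε)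
  open import Relation.Binary.Reasoning.Setoid setoid

  linear-combination : ∀ {x y a b c d} p q →
                       x - y ≈ p * (a - b) + q * (c - d) → a ≈ b → c ≈ d → x ≈ y
  linear-combination {x} {y} {a} {b} {c} {d} p q certificate a≈b c≈d =
    x∙y⁻¹≈ε⇒x≈y x y (begin
      x - y                      ≈⟨ certificate ⟩
      p * (a - b) + q * (c - d)  ≈⟨ +-cong (*-congˡ (x≈y⇒x∙y⁻¹≈ε a≈b)) (*-congˡ (x≈y⇒x∙y⁻¹≈ε c≈d)) ⟩
      p * 0# + q * 0#            ≈⟨ +-cong (zeroʳ p) (zeroʳ q) ⟩
      0# + 0#                    ≈⟨ +-identityˡ 0# ⟩
      0#                         ∎)

module PowerSeries where

  open import Algebra.Bundles using (CommutativeRing)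
  import Algebra.Construct.Pointwise as Pointwise
  open import Algebra.Solver.Ring.AlmostCommutativeRing using (_-Raw-AlmostCommutative⟶_; fromCommutativeRing)
  open import Algebra.Structures using (IsCommutativeRing)
  open import Data.Integer using (+_; -_; _+_; _*_)
  import Data.Integer.Base as ℤᵇ
  import Data.Integer.Properties as ℤ
  open import Algebra.Properties.AbelianGroup ℤ.+-0-abelianGroup using () renaming (∙-cancelʳ to +-cancelʳ)
  open import Data.Integer.Tactic.RingSolver using (solve-∀)
  open import Data.List using (foldr; applyUpTo)
  open import Data.List.Properties using (map-upTo)
  open import Data.Maybe using (Maybe)
  import Data.Maybe as Maybe
  open import Data.Nat using (ℕ; zero; suc; _∸_; _≤_; _<_; z≤n; s≤s)
  open import Data.Nat.Induction using (<-rec)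
  import Data.Nat.Properties as ℕ
  open import Data.Product using (_,_)
  open import Function using (_∘_)
  open import Level using (0ℓ)
  open import Relation.Binary.PropositionalEquality
  open import Relation.Nullary using (¬_)
  open import Relation.Nullary.Decidable using (dec⇒maybe)

  0ₛ : Series
  0ₛ _ = + 0

  1ₛ : Series
  1ₛ = const (+ 1)

  -ₛ_ : Series → Series
  (-ₛ f) n = - f n

  conv : Series → Series → Series
  conv f g zero    = f 0 * g 0
  conv f g (suc n) = f 0 * g (suc n) + conv (f ∘ suc) g n

  ⋆≗conv : ∀ f g → f ⋆ g ≗ conv f g
  ⋆≗conv f g n = trans (cong (foldr _+_ (+ 0)) (map-upTo (λ k → f k * g (n ∸ k)) (suc n))) (sum≡conv f g n)
    where
    sum≡conv : ∀ f g n → foldr _+_ (+ 0) (applyUpTo (λ k → f k * g (n ∸ k)) (suc n)) ≡ conv f g n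
    sum≡conv f g zero    = ℤ.+-identityʳ _
    sum≡conv f g (suc n) = cong (λ y → f 0 * g (suc n) + y) (sum≡conv (f ∘ suc) g n)

  conv-cong : ∀ {f f′ g g′} → f ≗ f′ → g ≗ g′ → conv f g ≗ conv f′ g′
  conv-cong f≗f′ g≗g′ zero    = cong₂ _*_ (f≗f′ 0) (g≗g′ 0)
  conv-cong f≗f′ g≗g′ (suc n) =
    cong₂ _+_ (cong₂ _*_ (f≗f′ 0) (g≗g′ (suc n))) (conv-cong (f≗f′ ∘ suc) g≗g′ n)

  conv-congʳ-≤ : ∀ f {g g′} m → (∀ k → k ≤ m → g k ≡ g′ k) → conv f g m ≡ conv f g′ m
  conv-congʳ-≤ f zero    g≡g′ = cong (f 0 *_) (g≡g′ 0 z≤n)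
  conv-congʳ-≤ f (suc m) g≡g′ =
    cong₂ _+_ (cong (f 0 *_) (g≡g′ (suc m) ℕ.≤-refl))
              (conv-congʳ-≤ (f ∘ suc) m (λ k k≤m → g≡g′ k (ℕ.m≤n⇒m≤1+n k≤m)))

  conv-zeroˡ : ∀ {f} g → f ≗ 0ₛ → conv f g ≗ 0ₛ
  conv-zeroˡ g f≗0 zero    = trans (cong (_* g 0) (f≗0 0)) (ℤ.*-zeroˡ (g 0))
  conv-zeroˡ g f≗0 (suc n) =
    cong₂ _+_ (trans (cong (_* g (suc n)) (f≗0 0)) (ℤ.*-zeroˡ (g (suc n)))) (conv-zeroˡ g (f≗0 ∘ suc) n)

  conv-identityˡ : ∀ g → conv 1ₛ g ≗ g
  conv-identityˡ g zero    = ℤ.*-identityˡ (g 0)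
  conv-identityˡ g (suc n) =
    trans (cong₂ _+_ (ℤ.*-identityˡ (g (suc n))) (conv-zeroˡ g (λ _ → refl) n)) (ℤ.+-identityʳ _)

  conv-distribʳ : ∀ f g h → conv (f ⊕ g) h ≗ conv f h ⊕ conv g h
  conv-distribʳ f g h zero    = ℤ.*-distribʳ-+ (h 0) (f 0) (g 0)
  conv-distribʳ f g h (suc n) rewrite conv-distribʳ (f ∘ suc) (g ∘ suc) h n =
    lemma (f 0) (g 0) (h (suc n)) (conv (f ∘ suc) h n) (conv (g ∘ suc) h n)
    where
    lemma : ∀ a b c x y → (a + b) * c + (x + y) ≡ (a * c + x) + (b * c + y)
    lemma = solve-∀

  conv-scaleˡ : ∀ c f g → conv ((c *_) ∘ f) g ≗ (c *_) ∘ conv f g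
  conv-scaleˡ c f g zero    = ℤ.*-assoc c (f 0) (g 0)
  conv-scaleˡ c f g (suc n) rewrite conv-scaleˡ c (f ∘ suc) g n =
    lemma c (f 0) (g (suc n)) (conv (f ∘ suc) g n)
    where
    lemma : ∀ c a b x → c * a * b + c * x ≡ c * (a * b + x)
    lemma = solve-∀

  conv-assoc : ∀ f g h → conv (conv f g) h ≗ conv f (conv g h)
  conv-assoc f g h zero    = ℤ.*-assoc (f 0) (g 0) (h 0)
  conv-assoc f g h (suc n)
    rewrite conv-distribʳ ((f 0 *_) ∘ g ∘ suc) (conv (f ∘ suc) g) h n
          | conv-scaleˡ (f 0) (g ∘ suc) h n
          | conv-assoc (f ∘ suc) g h n
    = lemma (f 0) (g 0) (h (suc n)) (conv (g ∘ suc) h n) (conv (f ∘ suc) (conv g h) n)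
    where
    lemma : ∀ a b c x y → a * b * c + (a * x + y) ≡ a * (b * c + x) + y
    lemma = solve-∀

  conv-sucʳ : ∀ f g n → conv f g (suc n) ≡ conv f (g ∘ suc) n + f (suc n) * g 0
  conv-sucʳ f g zero    = refl
  conv-sucʳ f g (suc n) rewrite conv-sucʳ (f ∘ suc) g n =
    sym (ℤ.+-assoc (f 0 * g (suc (suc n))) (conv (f ∘ suc) (g ∘ suc) n) _)

  conv-comm : ∀ f g → conv f g ≗ conv g f
  conv-comm f g zero    = ℤ.*-comm (f 0) (g 0)
  conv-comm f g (suc n) rewrite conv-sucʳ g f n | conv-comm (f ∘ suc) g n =
    trans (ℤ.+-comm (f 0 * g (suc n)) _) (cong (λ y → conv g (f ∘ suc) n + y) (ℤ.*-comm (f 0) (g (suc n))))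

  ⋆-cong : ∀ {f f′ g g′} → f ≗ f′ → g ≗ g′ → f ⋆ g ≗ f′ ⋆ g′
  ⋆-cong {f} {f′} {g} {g′} f≗f′ g≗g′ n = begin
    (f ⋆ g) n     ≡⟨ ⋆≗conv f g n ⟩
    conv f g n    ≡⟨ conv-cong f≗f′ g≗g′ n ⟩
    conv f′ g′ n  ≡⟨ ⋆≗conv f′ g′ n ⟨
    (f′ ⋆ g′) n   ∎
    where open ≡-Reasoning

  ⋆-comm : ∀ f g → f ⋆ g ≗ g ⋆ f
  ⋆-comm f g n = begin
    (f ⋆ g) n   ≡⟨ ⋆≗conv f g n ⟩
    conv f g n  ≡⟨ conv-comm f g n ⟩
    conv g f n  ≡⟨ ⋆≗conv g f n ⟨
    (g ⋆ f) n   ∎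
    where open ≡-Reasoning

  ⋆-assoc : ∀ f g h → (f ⋆ g) ⋆ h ≗ f ⋆ (g ⋆ h)
  ⋆-assoc f g h n = begin
    ((f ⋆ g) ⋆ h) n          ≡⟨ ⋆≗conv (f ⋆ g) h n ⟩
    conv (f ⋆ g) h n         ≡⟨ conv-cong (⋆≗conv f g) (λ _ → refl) n ⟩
    conv (conv f g) h n      ≡⟨ conv-assoc f g h n ⟩
    conv f (conv g h) n      ≡⟨ conv-cong (λ _ → refl) (⋆≗conv g h) n ⟨
    conv f (g ⋆ h) n         ≡⟨ ⋆≗conv f (g ⋆ h) n ⟨
    (f ⋆ (g ⋆ h)) n          ∎
    where open ≡-Reasoning

  ⋆-identityˡ : ∀ f → 1ₛ ⋆ f ≗ f
  ⋆-identityˡ f n = trans (⋆≗conv 1ₛ f n) (conv-identityˡ f n)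

  ⋆-distribʳ : ∀ h f g → (f ⊕ g) ⋆ h ≗ (f ⋆ h) ⊕ (g ⋆ h)
  ⋆-distribʳ h f g n = begin
    ((f ⊕ g) ⋆ h) n                 ≡⟨ ⋆≗conv (f ⊕ g) h n ⟩
    conv (f ⊕ g) h n                ≡⟨ conv-distribʳ f g h n ⟩
    conv f h n + conv g h n         ≡⟨ cong₂ _+_ (⋆≗conv f h n) (⋆≗conv g h n) ⟨
    (f ⋆ h) n + (g ⋆ h) n           ∎
    where open ≡-Reasoning

  ⋆-isCommutativeRing : IsCommutativeRing _≗_ _⊕_ _⋆_ -ₛ_ 0ₛ 1ₛ
  ⋆-isCommutativeRing = record
    { isRing = record
      { +-isAbelianGroup = Pointwise.isAbelianGroup ℕ ℤ.+-0-isAbelianGroup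
      ; *-cong     = ⋆-cong
      ; *-assoc    = ⋆-assoc
      ; *-identity = ⋆-identityˡ , λ f n → trans (⋆-comm f 1ₛ n) (⋆-identityˡ f n)
      ; distrib    = (λ h f g n → trans (⋆-comm h (f ⊕ g) n)
                                    (trans (⋆-distribʳ h f g n) (cong₂ _+_ (⋆-comm f h n) (⋆-comm g h n))))
                   , ⋆-distribʳ
      }
    ; *-comm = ⋆-comm
    }

  seriesRing : CommutativeRing 0ℓ 0ℓ
  seriesRing = record { isCommutativeRing = ⋆-isCommutativeRing }

  const-*-homo : ∀ a b → const (a * b) ≗ const a ⋆ const b
  const-*-homo a b n = trans (lemma n) (sym (⋆≗conv (const a) (const b) n))
    where
    lemma : ∀ n → const (a * b) n ≡ conv (const a) (const b) n
    lemma zero    = refl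
    lemma (suc n) = sym (cong₂ _+_ (ℤ.*-zeroʳ a) (conv-zeroˡ (const b) (λ _ → refl) n))

  const-homomorphism : ℤᵇ.+-*-rawRing -Raw-AlmostCommutative⟶ fromCommutativeRing seriesRing
  const-homomorphism = record
    { ⟦_⟧    = const
    ; +-homo = λ _ _ → λ { zero → refl ; (suc _) → refl }
    ; *-homo = const-*-homo
    ; -‿homo = λ _ → λ { zero → refl ; (suc _) → refl }
    ; 0-homo = λ { zero → refl ; (suc _) → refl }
    ; 1-homo = λ _ → refl
    }

  const-≟ : ∀ a b → Maybe (const a ≗ const b)
  const-≟ a b = Maybe.map (λ { refl _ → refl }) (dec⇒maybe (a ℤ.≟ b))

  open import Algebra.Solver.Ring ℤᵇ.+-*-rawRing (fromCommutativeRing seriesRing) const-homomorphism const-≟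
      using (solve; _:+_; _:-_; _:*_; :-_; con; _:=_) public

  -- Strong induction on k: the k-th coefficient of t ⋆ u is t₀ u_k plus terms involving
  -- only the u_j with j < k.
  ⋆-cancelʳ : ∀ {u v} t → ¬ t 0 ≡ + 0 → u ⋆ t ≗ v ⋆ t → u ≗ v
  ⋆-cancelʳ {u} {v} t t₀≢0 u⋆t≗v⋆t = <-rec (λ k → u k ≡ v k) agree
    where
    instance
      t₀-nonZero : ℤᵇ.NonZero (t 0)
      t₀-nonZero = ℤᵇ.≢-nonZero t₀≢0

    conv-agree : conv t u ≗ conv t v
    conv-agree n = begin
      conv t u n   ≡⟨ ⋆≗conv t u n ⟨
      (t ⋆ u) n    ≡⟨ ⋆-comm t u n ⟩
      (u ⋆ t) n    ≡⟨ u⋆t≗v⋆t n ⟩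
      (v ⋆ t) n    ≡⟨ ⋆-comm v t n ⟩
      (t ⋆ v) n    ≡⟨ ⋆≗conv t v n ⟩
      conv t v n   ∎
      where open ≡-Reasoning

    agree : ∀ k → (∀ {j} → j < k → u j ≡ v j) → u k ≡ v k
    agree zero    _  = ℤ.*-cancelˡ-≡ (t 0) (u 0) (v 0) (conv-agree 0)
    agree (suc m) ih = ℤ.*-cancelˡ-≡ (t 0) (u (suc m)) (v (suc m))
      (+-cancelʳ (conv (t ∘ suc) u m) (t 0 * u (suc m)) (t 0 * v (suc m)) (begin
        t 0 * u (suc m) + conv (t ∘ suc) u m  ≡⟨ conv-agree (suc m) ⟩
        t 0 * v (suc m) + conv (t ∘ suc) v m  ≡⟨ cong (λ y → t 0 * v (suc m) + y) lower-terms ⟨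
        t 0 * v (suc m) + conv (t ∘ suc) u m  ∎))
      where
      open ≡-Reasoning
      lower-terms : conv (t ∘ suc) u m ≡ conv (t ∘ suc) v m
      lower-terms = conv-congʳ-≤ (t ∘ suc) m (λ j j≤m → ih (s≤s j≤m))

  X⋆-zero : ∀ s → (X ⋆ s) 0 ≡ + 0
  X⋆-zero s = ⋆≗conv X s 0

  X⋆-suc : ∀ s n → (X ⋆ s) (suc n) ≡ s n
  X⋆-suc s n = begin
    (X ⋆ s) (suc n)               ≡⟨ ⋆≗conv X s (suc n) ⟩
    + 0 + conv (X ∘ suc) s n      ≡⟨ ℤ.+-identityˡ _ ⟩
    conv (X ∘ suc) s n            ≡⟨ conv-cong X∘suc≗1ₛ (λ _ → refl) n ⟩
    conv 1ₛ s n                   ≡⟨ conv-identityˡ s n ⟩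
    s n                           ∎
    where
    open ≡-Reasoning
    X∘suc≗1ₛ : X ∘ suc ≗ 1ₛ
    X∘suc≗1ₛ zero    = refl
    X∘suc≗1ₛ (suc _) = refl

  ≗X⋆ : ∀ {s} t → s 0 ≡ + 0 → (∀ n → s (suc n) ≡ t n) → s ≗ X ⋆ t
  ≗X⋆ t s₀≡0 s-suc zero    = trans s₀≡0 (sym (X⋆-zero t))
  ≗X⋆ t s₀≡0 s-suc (suc n) = trans (s-suc n) (sym (X⋆-suc t n))

  ≗1ₛ⊕X⋆ : ∀ {s} t → s 0 ≡ + 1 → (∀ n → s (suc n) ≡ t n) → s ≗ 1ₛ ⊕ (X ⋆ t)
  ≗1ₛ⊕X⋆ t s₀≡1 s-suc zero    = trans s₀≡1 (sym (cong (λ y → + 1 + y) (X⋆-zero t)))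
  ≗1ₛ⊕X⋆ t s₀≡1 s-suc (suc n) = trans (s-suc n) (sym (trans (ℤ.+-identityˡ _) (X⋆-suc t n)))

module Enumeration where
  open import Data.Empty using (⊥; ⊥-elim)
  import Data.Fin.Properties as Fin
  open import Data.Fin.Permutation using (↔⇒≡)
  open import Data.List using (List; []; _∷_)
  open import Data.List.Relation.Unary.Any using (Any; here; there)
  open import Data.Nat using (zero; suc; _+_; _*_; _≤_; _<_; z≤n; s≤s)
  import Data.Nat.Properties as ℕ
  open import Data.Nat.Induction using (<-rec)
  open import Data.Product using (Σ; _×_; _,_; proj₁; proj₂)
  open import Data.Product.Function.NonDependent.Propositional using (_×-↔_)
  open import Data.Sum using (_⊎_; inj₁; inj₂)
  open import Data.Sum.Function.Propositional using (_⊎-↔_)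
  open import Data.Unit using (⊤)
  open import Function using (_∘_)
  open import Function.Bundles using (mk↔ₛ′)
  open import Function.Properties.Inverse using (↔-sym; ↔-trans)
  open import Relation.Binary.PropositionalEquality using (refl; cong)

  Family : Set₁
  Family = ℕ → Set

  _⊗_ : Family → Family → Family
  (P ⊗ Q) m = Σ ℕ λ a → Σ ℕ λ b → a + b ≡ m × P a × Q b

  convℕ : (ℕ → ℕ) → (ℕ → ℕ) → ℕ → ℕ
  convℕ p q zero    = p 0 * q 0
  convℕ p q (suc m) = p 0 * q (suc m) + convℕ (p ∘ suc) q m

  ⊗-zero : ∀ {P Q} → (P ⊗ Q) 0 ↔ (P 0 × Q 0)
  ⊗-zero {P} {Q} = mk↔ₛ′ split join (λ _ → refl) join∘split
    where
    split : (P ⊗ Q) 0 → P 0 × Q 0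
    split (zero , zero , refl , x , y) = x , y
    join : P 0 × Q 0 → (P ⊗ Q) 0
    join (x , y) = 0 , 0 , refl , x , y
    join∘split : ∀ z → join (split z) ≡ z
    join∘split (zero , zero , refl , x , y) = refl

  ⊗-suc : ∀ {P Q} m → (P ⊗ Q) (suc m) ↔ (P 0 × Q (suc m) ⊎ ((P ∘ suc) ⊗ Q) m)
  ⊗-suc {P} {Q} m = mk↔ₛ′ split join split∘join join∘split
    where
    split : ∀ {m} → (P ⊗ Q) (suc m) → P 0 × Q (suc m) ⊎ ((P ∘ suc) ⊗ Q) m
    split (zero  , b , refl , x , y) = inj₁ (x , y)
    split (suc a , b , e    , x , y) = inj₂ (a , b , ℕ.suc-injective e , x , y)
    join : ∀ {m} → P 0 × Q (suc m) ⊎ ((P ∘ suc) ⊗ Q) m → (P ⊗ Q) (suc m)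
    join (inj₁ (x , y))             = 0 , _ , refl , x , y
    join (inj₂ (a , b , e , x , y)) = suc a , b , cong suc e , x , y
    split∘join : ∀ {m} z → split {m} (join z) ≡ z
    split∘join (inj₁ _)                    = refl
    split∘join (inj₂ (a , b , refl , x , y)) = refl
    join∘split : ∀ {m} z → join {m} (split z) ≡ z
    join∘split (zero  , b , refl , x , y) = refl
    join∘split (suc a , b , refl , x , y) = refl

  ×-count : ∀ {A B : Set} {m n} → A ↔ Fin m → B ↔ Fin n → (A × B) ↔ Fin (m * n)
  ×-count A↔m B↔n = ↔-trans (A↔m ×-↔ B↔n) (↔-sym Fin.*↔×)

  ⊎-count : ∀ {A B : Set} {m n} → A ↔ Fin m → B ↔ Fin n → (A ⊎ B) ↔ Fin (m + n)
  ⊎-count A↔m B↔n = ↔-trans (A↔m ⊎-↔ B↔n) (↔-sym Fin.+↔⊎)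

  count-unique : ∀ {A : Set} {m n} → A ↔ Fin m → A ↔ Fin n → m ≡ n
  count-unique A↔m A↔n = ↔⇒≡ (↔-trans (↔-sym A↔m) A↔n)

  ⊗-count : ∀ {P Q p q} → (∀ a → P a ↔ Fin (p a)) → (∀ b → Q b ↔ Fin (q b)) →
            ∀ m → (P ⊗ Q) m ↔ Fin (convℕ p q m)
  ⊗-count P↔p Q↔q zero    = ↔-trans ⊗-zero (×-count (P↔p 0) (Q↔q 0))
  ⊗-count P↔p Q↔q (suc m) =
    ↔-trans (⊗-suc m) (⊎-count (×-count (P↔p 0) (Q↔q (suc m))) (⊗-count (P↔p ∘ suc) Q↔q m))

  Finite : Set → Set
  Finite A = Σ ℕ λ n → A ↔ Fin n

  Finite-↔ : ∀ {A B : Set} → A ↔ B → Finite B → Finite A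
  Finite-↔ A↔B (n , B↔n) = n , ↔-trans A↔B B↔n

  Finite-× : ∀ {A B : Set} → Finite A → Finite B → Finite (A × B)
  Finite-× (m , A↔m) (n , B↔n) = m * n , ×-count A↔m B↔n

  Finite-⊎ : ∀ {A B : Set} → Finite A → Finite B → Finite (A ⊎ B)
  Finite-⊎ (m , A↔m) (n , B↔n) = m + n , ⊎-count A↔m B↔n

  ⊗-finite : ∀ {P Q} m → (∀ a → a ≤ m → Finite (P a)) → (∀ b → b ≤ m → Finite (Q b)) →
             Finite ((P ⊗ Q) m)
  ⊗-finite zero    P-fin Q-fin = Finite-↔ ⊗-zero (Finite-× (P-fin 0 z≤n) (Q-fin 0 z≤n))
  ⊗-finite (suc m) P-fin Q-fin = Finite-↔ (⊗-suc m) (Finite-⊎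
    (Finite-× (P-fin 0 z≤n) (Q-fin (suc m) ℕ.≤-refl))
    (⊗-finite m (λ a a≤m → P-fin (suc a) (s≤s a≤m)) (λ b b≤m → Q-fin b (ℕ.m≤n⇒m≤1+n b≤m))))

  Trees : Family
  Trees n = Σ Tree λ t → edges t ≡ n

  Forests : Family
  Forests n = Σ (List Tree) λ ts → edgesF ts ≡ n

  ChainedForests : Family
  ChainedForests n = Σ (List Tree) λ ts → edgesF ts ≡ n × Any Chain ts

  Trees↔Forests : ∀ n → Trees n ↔ Forests n
  Trees↔Forests n = mk↔ₛ′ subtrees node′ (λ _ → refl) node′∘subtrees
    where
    subtrees : Trees n → Forests n
    subtrees (node ts , e) = ts , e
    node′ : Forests n → Trees n
    node′ (ts , e) = node ts , e
    node′∘subtrees : ∀ t → node′ (subtrees t) ≡ t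
    node′∘subtrees (node ts , e) = refl

  Forests-zero : Forests 0 ↔ ⊤
  Forests-zero = mk↔ₛ′ _ (λ _ → [] , refl) (λ _ → refl) empty-unique
    where
    empty-unique : ∀ f → ([] , refl) ≡ f
    empty-unique ([] , refl) = refl

  Forests-suc : ∀ m → Forests (suc m) ↔ (Trees ⊗ Forests) m
  Forests-suc m = mk↔ₛ′ uncons cons uncons∘cons cons∘uncons
    where
    uncons : ∀ {m} → Forests (suc m) → (Trees ⊗ Forests) m
    uncons (t ∷ ts , e) = edges t , edgesF ts , ℕ.suc-injective e , (t , refl) , (ts , refl)
    cons : ∀ {m} → (Trees ⊗ Forests) m → Forests (suc m)
    cons (_ , _ , e , (t , refl) , (ts , refl)) = t ∷ ts , cong suc e
    uncons∘cons : ∀ {m} z → uncons {m} (cons z) ≡ z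
    uncons∘cons (_ , _ , refl , (t , refl) , (ts , refl)) = refl
    cons∘uncons : ∀ {m} f → cons {m} (uncons f) ≡ f
    cons∘uncons (t ∷ ts , refl) = refl

  ChainedForests-zero : ChainedForests 0 ↔ ⊥
  ChainedForests-zero = mk↔ₛ′ no-chain (λ ()) (λ ()) (λ f → ⊥-elim (no-chain f))
    where
    no-chain : ChainedForests 0 → ⊥
    no-chain ([] , _ , ())

  ChainedForests-suc : ∀ m →
    ChainedForests (suc m) ↔ ((Pairs ⊗ Forests) m ⊎ (Trees ⊗ ChainedForests) m)
  ChainedForests-suc m = mk↔ₛ′ uncons cons uncons∘cons cons∘uncons
    where
    uncons : ∀ {m} → ChainedForests (suc m) → (Pairs ⊗ Forests) m ⊎ (Trees ⊗ ChainedForests) m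
    uncons (t ∷ ts , e , here q)  = inj₁ (edges t , edgesF ts , ℕ.suc-injective e , (t , refl , q) , (ts , refl))
    uncons (t ∷ ts , e , there q) = inj₂ (edges t , edgesF ts , ℕ.suc-injective e , (t , refl) , (ts , refl , q))
    cons : ∀ {m} → (Pairs ⊗ Forests) m ⊎ (Trees ⊗ ChainedForests) m → ChainedForests (suc m)
    cons (inj₁ (_ , _ , e , (t , refl , q) , (ts , refl))) = t ∷ ts , cong suc e , here q
    cons (inj₂ (_ , _ , e , (t , refl) , (ts , refl , q))) = t ∷ ts , cong suc e , there q
    uncons∘cons : ∀ {m} z → uncons {m} (cons z) ≡ z
    uncons∘cons (inj₁ (_ , _ , refl , (t , refl , q) , (ts , refl))) = refl
    uncons∘cons (inj₂ (_ , _ , refl , (t , refl) , (ts , refl , q))) = refl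
    cons∘uncons : ∀ {m} f → cons {m} (uncons f) ≡ f
    cons∘uncons (t ∷ ts , refl , here q)  = refl
    cons∘uncons (t ∷ ts , refl , there q) = refl

  Pairs↔ : ∀ n → Pairs n ↔ (Forests n ⊎ ChainedForests n ⊎ ChainedForests n)
  Pairs↔ n = mk↔ₛ′ classify unclassify classify∘unclassify unclassify∘classify
    where
    classify : Pairs n → Forests n ⊎ ChainedForests n ⊎ ChainedForests n
    classify (node ts , e , rootOnly)    = inj₁ (ts , e)
    classify (node ts , e , rootAnd q)   = inj₂ (inj₁ (ts , e , q))
    classify (node ts , e , belowRoot q) = inj₂ (inj₂ (ts , e , q))
    unclassify : Forests n ⊎ ChainedForests n ⊎ ChainedForests n → Pairs n
    unclassify (inj₁ (ts , e))             = node ts , e , rootOnly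
    unclassify (inj₂ (inj₁ (ts , e , q))) = node ts , e , rootAnd q
    unclassify (inj₂ (inj₂ (ts , e , q))) = node ts , e , belowRoot q
    classify∘unclassify : ∀ z → classify (unclassify z) ≡ z
    classify∘unclassify (inj₁ _)        = refl
    classify∘unclassify (inj₂ (inj₁ _)) = refl
    classify∘unclassify (inj₂ (inj₂ _)) = refl
    unclassify∘classify : ∀ p → unclassify (classify p) ≡ p
    unclassify∘classify (node ts , e , rootOnly)    = refl
    unclassify∘classify (node ts , e , rootAnd q)   = refl
    unclassify∘classify (node ts , e , belowRoot q) = refl

  Forests-finite : ∀ n → Finite (Forests n)
  Forests-finite = <-rec _ finite
    where
    finite : ∀ n → (∀ {k} → k < n → Finite (Forests k)) → Finite (Forests n)
    finite zero    _   = Finite-↔ Forests-zero (1 , ↔-sym Fin.1↔⊤)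
    finite (suc m) rec = Finite-↔ (Forests-suc m) (⊗-finite m
      (λ a a≤m → Finite-↔ (Trees↔Forests a) (rec (s≤s a≤m))) (λ b b≤m → rec (s≤s b≤m)))

  catalan : ℕ → ℕ
  catalan n = proj₁ (Forests-finite n)

  Forests↔catalan : ∀ n → Forests n ↔ Fin (catalan n)
  Forests↔catalan n = proj₂ (Forests-finite n)

  Trees↔catalan : ∀ n → Trees n ↔ Fin (catalan n)
  Trees↔catalan n = ↔-trans (Trees↔Forests n) (Forests↔catalan n)

  catalan-zero : catalan 0 ≡ 1
  catalan-zero = count-unique (Forests↔catalan 0) (↔-trans Forests-zero (↔-sym Fin.1↔⊤))

  catalan-suc : ∀ m → catalan (suc m) ≡ convℕ catalan catalan m
  catalan-suc m = count-unique (Forests↔catalan (suc m))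
    (↔-trans (Forests-suc m) (⊗-count Trees↔catalan Forests↔catalan m))

  module ChainCounts (H : ℕ → ℕ) (Pairs↔H : ∀ n → Pairs n ↔ Fin (H n)) where

    ChainedForests-finite : ∀ n → Finite (ChainedForests n)
    ChainedForests-finite = <-rec _ finite
      where
      finite : ∀ n → (∀ {k} → k < n → Finite (ChainedForests k)) → Finite (ChainedForests n)
      finite zero    _   = Finite-↔ ChainedForests-zero (0 , ↔-sym Fin.0↔⊥)
      finite (suc m) rec = Finite-↔ (ChainedForests-suc m) (Finite-⊎
        (⊗-finite m (λ a _ → H a , Pairs↔H a) (λ b _ → Forests-finite b))
        (⊗-finite m (λ a _ → Finite-↔ (Trees↔Forests a) (Forests-finite a))
                    (λ b b≤m → rec (s≤s b≤m))))

    chained : ℕ → ℕ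
    chained n = proj₁ (ChainedForests-finite n)

    ChainedForests↔chained : ∀ n → ChainedForests n ↔ Fin (chained n)
    ChainedForests↔chained n = proj₂ (ChainedForests-finite n)

    chained-zero : chained 0 ≡ 0
    chained-zero = count-unique (ChainedForests↔chained 0) (↔-trans ChainedForests-zero (↔-sym Fin.0↔⊥))

    chained-suc : ∀ m → chained (suc m) ≡ convℕ H catalan m + convℕ catalan chained m
    chained-suc m = count-unique (ChainedForests↔chained (suc m))
      (↔-trans (ChainedForests-suc m)
               (⊎-count (⊗-count Pairs↔H Forests↔catalan m)
                        (⊗-count Trees↔catalan ChainedForests↔chained m)))

    H≡catalan+2chained : ∀ n → H n ≡ catalan n + (chained n + chained n)
    H≡catalan+2chained n = count-unique (Pairs↔H n)
      (↔-trans (Pairs↔ n)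
               (⊎-count (Forests↔catalan n) (⊎-count (ChainedForests↔chained n) (ChainedForests↔chained n))))

module GeneratingFunctions where
  open PowerSeries
  open Enumeration
  open import Algebra.Bundles using (CommutativeRing)
  open import Data.Integer using (_+_; _-_; _*_)
  import Data.Integer.Properties as ℤ
  open import Data.Nat using (zero; suc)
  import Data.Nat as ℕ
  open import Function using (_∘_)
  open import Relation.Binary.PropositionalEquality using (_≗_; refl; sym; trans; cong; cong₂)
  open import Relation.Nullary using (¬_)

  ofℕ-convℕ : ∀ p q → ofℕ (convℕ p q) ≗ ofℕ p ⋆ ofℕ q
  ofℕ-convℕ p q n = trans (ofℕ-convℕ≡conv p q n) (sym (⋆≗conv (ofℕ p) (ofℕ q) n))
    where
    ofℕ-convℕ≡conv : ∀ p q n → + convℕ p q n ≡ conv (ofℕ p) (ofℕ q) n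
    ofℕ-convℕ≡conv p q zero    = ℤ.pos-* (p 0) (q 0)
    ofℕ-convℕ≡conv p q (suc n) =
      trans (ℤ.pos-+ (p 0 ℕ.* q (suc n)) _)
            (cong₂ _+_ (ℤ.pos-* (p 0) (q (suc n))) (ofℕ-convℕ≡conv (p ∘ suc) q n))

  catalan-gf : ofℕ catalan ≗ 1ₛ ⊕ (X ⋆ (ofℕ catalan ⋆ ofℕ catalan))
  catalan-gf = ≗1ₛ⊕X⋆ _ (cong +_ catalan-zero)
    (λ m → trans (cong +_ (catalan-suc m)) (ofℕ-convℕ catalan catalan m))

  module ChainSeries (H : ℕ → ℕ) (Pairs↔H : ∀ n → Pairs n ↔ Fin (H n)) where
    open ChainCounts H Pairs↔H

    chained-gf : ofℕ chained ≗ X ⋆ ((ofℕ H ⋆ ofℕ catalan) ⊕ (ofℕ catalan ⋆ ofℕ chained))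
    chained-gf = ≗X⋆ _ (cong +_ chained-zero) λ m →
      trans (cong +_ (chained-suc m))
            (trans (ℤ.pos-+ (convℕ H catalan m) _)
                   (cong₂ _+_ (ofℕ-convℕ H catalan m) (ofℕ-convℕ catalan chained m)))

    H-gf : ofℕ H ≗ ofℕ catalan ⊕ (ofℕ chained ⊕ ofℕ chained)
    H-gf n = trans (cong +_ (H≡catalan+2chained n))
                   (trans (ℤ.pos-+ (catalan n) _) (cong (λ y → + catalan n + y) (ℤ.pos-+ (chained n) _)))

  open CommutativeRing seriesRing using (ring)

  ≡+suc⇒≢0 : ∀ {i k} → i ≡ + suc k → ¬ i ≡ + 0
  ≡+suc⇒≢0 refl ()

  module _ {F C G : Series}
           (F-eq : F ≗ 1ₛ ⊕ (X ⋆ (F ⋆ F)))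
           (C-eq : C ≗ X ⋆ ((G ⋆ F) ⊕ (F ⋆ C)))
           (G-eq : G ≗ F ⊕ (C ⊕ C)) where

    C≗[F-1]G : C ≗ (F ⊖ 1ₛ) ⋆ G
    C≗[F-1]G = linear-combination ring F (-ₛ (G ⊕ C))
      (solve 4 (λ F C G X → C :- ((F :- con (+ 1)) :* G) :=
                  F :* (C :- X :* (G :* F :+ F :* C)) :+ (:- (G :+ C)) :* (F :- (con (+ 1) :+ X :* (F :* F))))
               (λ _ → refl) F C G X)
      C-eq F-eq

    G⋆[3-2F]≗F : G ⋆ (const (+ 3) ⊖ (const (+ 2) ⋆ F)) ≗ F
    G⋆[3-2F]≗F = linear-combination ring 1ₛ (const (+ 2))
      (solve 3 (λ F C G → G :* (con (+ 3) :- con (+ 2) :* F) :- F :=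
                  con (+ 1) :* (G :- (F :+ (C :+ C))) :+ con (+ 2) :* (C :- (F :- con (+ 1)) :* G))
               (λ _ → refl) F C G)
      G-eq C≗[F-1]G

    F₀≡1 : F 0 ≡ + 1
    F₀≡1 = trans (F-eq 0) (cong (λ y → + 1 + y) (X⋆-zero (F ⋆ F)))

    module _ {B : Series} (B₀≡1 : B 0 ≡ + 1) (B-eq : (B ⋆ B) ⋆ oneMinus4x ≗ 1ₛ) where

      B⋆[2-F]≗F : B ⋆ (const (+ 2) ⊖ F) ≗ F
      B⋆[2-F]≗F = ⋆-cancelʳ (P ⊕ F) (≡+suc⇒≢0 [P+F]₀≡2) (⋆-cancelʳ oneMinus4x (λ ()) squares)
        where
        P : Series
        P = B ⋆ (const (+ 2) ⊖ F)
        squares : (P ⋆ (P ⊕ F)) ⋆ oneMinus4x ≗ (F ⋆ (P ⊕ F)) ⋆ oneMinus4x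
        squares = linear-combination ring ((const (+ 2) ⊖ F) ⋆ (const (+ 2) ⊖ F)) (-ₛ const (+ 4))
          (solve 3 (λ F B X →
                      (B :* (con (+ 2) :- F)) :* (B :* (con (+ 2) :- F) :+ F) :* (con (+ 1) :- con (+ 4) :* X)
                      :- F :* (B :* (con (+ 2) :- F) :+ F) :* (con (+ 1) :- con (+ 4) :* X) :=
                      (con (+ 2) :- F) :* (con (+ 2) :- F) :* (B :* B :* (con (+ 1) :- con (+ 4) :* X) :- con (+ 1))
                      :+ (:- con (+ 4)) :* (F :- (con (+ 1) :+ X :* (F :* F))))
                   (λ _ → refl) F B X)
          B-eq F-eq
        [P+F]₀≡2 : (P ⊕ F) 0 ≡ + 2
        [P+F]₀≡2 = trans (cong (λ y → y + F 0) (⋆≗conv B (const (+ 2) ⊖ F) 0))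
                         (cong₂ (λ b f → b * (+ 2 - f) + f) B₀≡1 F₀≡1)

      G⋆[3-B]≗2B : G ⋆ (const (+ 3) ⊖ B) ≗ const (+ 2) ⋆ B
      G⋆[3-B]≗2B = ⋆-cancelʳ (const (+ 2) ⊖ F) (≡+suc⇒≢0 (cong (λ f → + 2 - f) F₀≡1))
        (linear-combination ring (const (+ 2)) (-ₛ (G ⊕ const (+ 2)))
          (solve 3 (λ F G B →
                      G :* (con (+ 3) :- B) :* (con (+ 2) :- F) :- con (+ 2) :* B :* (con (+ 2) :- F) :=
                      con (+ 2) :* (G :* (con (+ 3) :- con (+ 2) :* F) :- F)
                      :+ (:- (G :+ con (+ 2))) :* (B :* (con (+ 2) :- F) :- F))
                   (λ _ → refl) F G B)
          G⋆[3-2F]≗F B⋆[2-F]≗F)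

theorem6p2 : (H : ℕ → ℕ) → (∀ n → Pairs n ↔ Fin (H n))
    → (B : Series) → B 0 ≡ + 1 → (∀ n → ((B ⋆ B) ⋆ oneMinus4x) n ≡ const (+ 1) n)
    → ∀ n → (ofℕ H ⋆ (const (+ 3) ⊖ B)) n ≡ (const (+ 2) ⋆ B) n
theorem6p2 H Pairs↔H B B₀≡1 B-eq =
  G⋆[3-B]≗2B catalan-gf chained-gf H-gf B₀≡1 B-eq
  where
  open GeneratingFunctions
  open ChainSeries H Pairs↔H
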